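{- Let $N = p^k m^2$ be an odd perfect number given in Eulerian form satisfying $m^2 - p^k = 2^r t$, where $r \geq 2$ is an integer and $t$ is a positive integer with $\gcd(2,t)=1$. Then $m \neq t$.
   Context: A positive integer $N$ is an odd perfect number if $N$ is odd and $\sigma(N) = 2N$, where $\sigma$ denotes the sum-of-divisors function. An odd perfect number is said to be given in Eulerian form $N = p^k m^2$ if $p$ is a prime (the special prime), $k$ and $m$ are positive integers, $p \equiv k \equiv 1 \pmod 4$, and $\gcd(p,m) = 1$. -}

module Defs where

open import Data.Nat using (ℕ; suc; _+_; _*_; _^_; _%_)
open import Data.Nat.Divisibility using (_∣?_)
open import Data.List using (List; filter; upTo; map)
open import Data.Nat.ListAction using (sum)
open import Data.Product using (_×_)
open import Relation.Binary.PropositionalEquality using (_≡_)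

divisors : ℕ → List ℕ
divisors n = filter (_∣? n) (map suc (upTo n))

σ : ℕ → ℕ
σ n = sum (divisors n)

Odd : ℕ → Set
Odd n = n % 2 ≡ 1

-- N is an odd perfect number: N odd (hence positive) and σ(N) = 2N
OddPerfect : ℕ → Set
OddPerfect N = Odd N × (σ N ≡ 2 * N)

{-# OPTIONS --safe #-}
module Submission where

open import Defs
open import Data.Nat using (ℕ; _+_; _*_; _^_; _≤_; _<_; _%_; zero; suc; s≤s; z≤n)
open import Data.Nat.GCD using (gcd)
open import Data.Nat.Primality using (Prime)
open import Data.Nat.Divisibility using (_∣_; ∣1⇒≡1; ∣m+n∣m⇒∣n; n∣m*n; m∣m*n)
open import Data.Nat.Coprimality using (Coprime; gcd≡1⇒coprime; coprime-divisor)
import Data.Nat.Coprimality as Coprimality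
open import Data.Nat.Properties
open import Relation.Binary.PropositionalEquality using (_≡_; _≢_; subst; sym; trans; refl)

-- Suppose m = t. Then m divides m² − 2ʳm = pᵏ, and m is coprime to p, so m = 1.
-- But then 1 = m² = pᵏ + 2ʳ ≥ 4, which is absurd. Only gcd(p, m) = 1 and r ≥ 2 are used.

coprime-∣^⇒≡1 : ∀ {m p} k → Coprime m p → m ∣ p ^ k → m ≡ 1
coprime-∣^⇒≡1 zero    _      m∣1    = ∣1⇒≡1 m∣1
coprime-∣^⇒≡1 (suc k) coprime m∣p^k = coprime-∣^⇒≡1 k coprime (coprime-divisor coprime m∣p^k)

^2≡n+o*m⇒∣n : ∀ {m n} o → m ^ 2 ≡ n + o * m → m ∣ n
^2≡n+o*m⇒∣n {m} {n} o eq = ∣m+n∣m⇒∣n m∣o*m+n (n∣m*n o)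
  where
  m∣o*m+n : m ∣ o * m + n
  m∣o*m+n = subst (m ∣_) (trans eq (+-comm n (o * m))) (m∣m*n (m * 1))

1<n+2^r*1 : ∀ n {r} → 2 ≤ r → 1 < n + 2 ^ r * 1
1<n+2^r*1 n {r} 2≤r = begin-strict
  1             <⟨ s≤s (s≤s z≤n) ⟩
  2 ^ 2         ≤⟨ ^-monoʳ-≤ 2 2≤r ⟩
  2 ^ r         ≡⟨ sym (*-identityʳ (2 ^ r)) ⟩
  2 ^ r * 1     ≤⟨ m≤n+m (2 ^ r * 1) n ⟩
  n + 2 ^ r * 1 ∎
  where open ≤-Reasoning

lemma5 : (N p k m r t : ℕ) → OddPerfect N → N ≡ p ^ k * (m ^ 2) →
    Prime p → 1 ≤ k → 1 ≤ m → p % 4 ≡ 1 → k % 4 ≡ 1 → gcd p m ≡ 1 →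
    2 ≤ r → 1 ≤ t → gcd 2 t ≡ 1 → m ^ 2 ≡ p ^ k + 2 ^ r * t →
    m ≢ t
lemma5 N p k m r t _ _ _ _ _ _ _ gcd[p,m]≡1 2≤r _ _ m²≡pᵏ+2ʳm refl
  with coprime-∣^⇒≡1 k (Coprimality.sym (gcd≡1⇒coprime gcd[p,m]≡1)) (^2≡n+o*m⇒∣n (2 ^ r) m²≡pᵏ+2ʳm)
... | refl = <⇒≢ (1<n+2^r*1 (p ^ k) 2≤r) m²≡pᵏ+2ʳm
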